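{- Let $T$ be an $n\times n$ ranking table presenting a 3-concordant ranking system. Let $T'$ be obtained from $T$ by a consecutive transposition that selects row $i$ and rank $s$ (with $1\le s\le n-2$), where $r_i(j)=s$ and $r_i(k)=s+1$, and swaps these two ranks. Then $T'$ also presents a 3-concordant ranking system, unless $r_j(i)<r_j(k)$ and $r_k(j)<r_k(i)$ (the ranks being those of $T$, in rows $j$ and $k$, which the transposition does not change).
   Context: Ranking table. For objects $x_1,\dots,x_n$, a ranking table $T$ is an $n\times n$ array with entries $r_i(j)$ such that: - $r_i(i)=0$; - for each $i$, the map $j\mapsto r_i(j)$ is a bijection from $\{1,\dots,n\}\setminus\{i\}$ onto $\{1,\dots,n-1\}$. Here $r_i(j)$ is the rank awarded to $x_j$ by $x_i$. 3-concordance. $T$ presents a 3-concordant ranking system if there are no distinct $i,j,k$ with $r_i(j)<r_i(k)$, $r_j(k)<r_j(i)$ and $r_k(i)<r_k(j)$. Consecutive transposition. Choose a row $i$ and a rank $s$ with $1\le s\le n-2$. Let $j,k$ satisfy $r_i(j)=s$ and $r_i(k)=s+1$. Redefine $r_i(j)=s+1$ and $r_i(k)=s$, leaving all other entries unchanged. -}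

module Defs where

open import Data.Nat using (ℕ; suc; _≤_; _<_; _∸_)
open import Data.Fin using (Fin; _≟_)
open import Data.Product using (_×_; ∃-syntax)
open import Relation.Nullary using (¬_; yes; no)
open import Relation.Binary.PropositionalEquality using (_≡_)

-- A table for n objects: T i j = r_i(j), the rank awarded to x_j by x_i.
Table : ℕ → Set
Table n = Fin n → Fin n → ℕ

record IsRankingTable {n : ℕ} (T : Table n) : Set where
  field
    diag     : ∀ i → T i i ≡ 0
    range    : ∀ i j → ¬ (j ≡ i) → 1 ≤ T i j × T i j ≤ n ∸ 1
    injective : ∀ i j k → ¬ (j ≡ i) → ¬ (k ≡ i) → T i j ≡ T i k → j ≡ k
    surjective : ∀ i (r : ℕ) → 1 ≤ r → r ≤ n ∸ 1 → ∃[ j ] (¬ (j ≡ i) × T i j ≡ r)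

ThreeConcordant : {n : ℕ} → Table n → Set
ThreeConcordant {n} T =
  ∀ (i j k : Fin n) → ¬ (i ≡ j) → ¬ (j ≡ k) → ¬ (i ≡ k) →
  ¬ (T i j < T i k × T j k < T j i × T k i < T k j)

Presents3Concordant : {n : ℕ} → Table n → Set
Presents3Concordant T = IsRankingTable T × ThreeConcordant T

swapInRow : {n : ℕ} → Table n → Fin n → Fin n → Fin n → Table n
swapInRow T i j k a b with a ≟ i
... | no _ = T a b
... | yes _ with b ≟ j
...   | yes _ = T i k
...   | no _ with b ≟ k
...     | yes _ = T i j
...     | no _ = T a b

record ConsecutiveTransposition {n : ℕ} (T T' : Table n) (i : Fin n) (s : ℕ) (j k : Fin n) : Set where
  field
    s-lower : 1 ≤ s
    s-upper : s ≤ n ∸ 2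
    rank-j  : T i j ≡ s
    rank-k  : T i k ≡ suc s
    result  : T' ≡ swapInRow T i j k

-- Only row i changes, and it changes by exchanging the adjacent ranks s and s+1, so it
-- still ranks the other objects bijectively.  A 3-cycle of T' not through x_i is a 3-cycle of
-- T.  A 3-cycle through x_i reverses in row i at most the pair (x_k, x_j), the only pair
-- whose relative order the transposition changes; it is then the cycle i → k → j, whose
-- other two inequalities are exactly the excluded ones r_j(i) < r_j(k) and r_k(j) < r_k(i).
module Submission where

open import Defs
open import Data.Nat using (ℕ; suc; _≤_; _<_; _∸_; z≤n; s≤s; s≤s⁻¹)
open import Data.Nat.Properties
  using (_≟_; <-irrefl; <-asym; <-trans; n<1+n; m<n⇒m<1+n; ≤∧≢⇒<; <⇒≢; <⇒≤)
open import Data.Fin using (Fin)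
import Data.Fin.Properties as Fin
open import Data.Product using (_×_; _,_; proj₂; ∃-syntax)
open import Data.Sum using (_⊎_; inj₁; inj₂)
open import Function using (_∘_)
open import Relation.Nullary using (¬_; yes; no; contradiction)
open import Relation.Binary.PropositionalEquality
  using (_≡_; _≢_; refl; sym; trans; subst; subst₂)

swapWithSuc : ℕ → ℕ → ℕ
swapWithSuc s m with m ≟ s
... | yes _ = suc s
... | no _ with m ≟ suc s
...   | yes _ = s
...   | no _ = m

data SwapWithSuc (s : ℕ) : ℕ → ℕ → Set where
  lower : SwapWithSuc s s (suc s)
  upper : SwapWithSuc s (suc s) s
  fixed : ∀ {m} → m ≢ s → m ≢ suc s → SwapWithSuc s m m

swapWithSuc-view : ∀ s m → SwapWithSuc s m (swapWithSuc s m)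
swapWithSuc-view s m with m ≟ s
... | yes refl = lower
... | no m≢s with m ≟ suc s
...   | yes refl = upper
...   | no m≢1+s = fixed m≢s m≢1+s

module _ {s : ℕ} where

  SwapWithSuc-sym : ∀ {m m′} → SwapWithSuc s m m′ → SwapWithSuc s m′ m
  SwapWithSuc-sym lower = upper
  SwapWithSuc-sym upper = lower
  SwapWithSuc-sym (fixed m≢s m≢1+s) = fixed m≢s m≢1+s

  SwapWithSuc-functional : ∀ {m m′ m″} → SwapWithSuc s m m′ → SwapWithSuc s m m″ → m′ ≡ m″
  SwapWithSuc-functional lower lower = refl
  SwapWithSuc-functional lower (fixed m≢s _) = contradiction refl m≢s
  SwapWithSuc-functional upper upper = refl
  SwapWithSuc-functional upper (fixed _ m≢1+s) = contradiction refl m≢1+s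
  SwapWithSuc-functional (fixed m≢s _) lower = contradiction refl m≢s
  SwapWithSuc-functional (fixed _ m≢1+s) upper = contradiction refl m≢1+s
  SwapWithSuc-functional (fixed _ _) (fixed _ _) = refl

  SwapWithSuc-injective : ∀ {m m′ m″} → SwapWithSuc s m m″ → SwapWithSuc s m′ m″ → m ≡ m′
  SwapWithSuc-injective p q = SwapWithSuc-functional (SwapWithSuc-sym p) (SwapWithSuc-sym q)

  SwapWithSuc-fixes-0 : 1 ≤ s → ∀ {m m′} → SwapWithSuc s m m′ → m ≡ 0 → m′ ≡ 0
  SwapWithSuc-fixes-0 1≤s lower refl = contradiction refl (<⇒≢ 1≤s)
  SwapWithSuc-fixes-0 1≤s (fixed _ _) m≡0 = m≡0

  SwapWithSuc-preserves-range : ∀ {N} → 1 ≤ s → suc s ≤ N → ∀ {m m′} → SwapWithSuc s m m′ →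
                                1 ≤ m × m ≤ N → 1 ≤ m′ × m′ ≤ N
  SwapWithSuc-preserves-range _ 1+s≤N lower _ = s≤s z≤n , 1+s≤N
  SwapWithSuc-preserves-range 1≤s _ upper (_ , 1+s≤N) = 1≤s , <⇒≤ 1+s≤N
  SwapWithSuc-preserves-range _ _ (fixed _ _) m∈range = m∈range

  SwapWithSuc-reflects-< : ∀ {a a′ b b′} → SwapWithSuc s a a′ → SwapWithSuc s b b′ →
                           a′ < b′ → a < b ⊎ (a ≡ suc s × b ≡ s)
  SwapWithSuc-reflects-< lower lower lt = contradiction lt (<-irrefl refl)
  SwapWithSuc-reflects-< lower upper lt = contradiction (n<1+n s) (<-asym lt)
  SwapWithSuc-reflects-< lower (fixed _ _) lt = inj₁ (<-trans (n<1+n s) lt)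
  SwapWithSuc-reflects-< upper lower lt = inj₂ (refl , refl)
  SwapWithSuc-reflects-< upper upper lt = contradiction lt (<-irrefl refl)
  SwapWithSuc-reflects-< upper (fixed _ b≢1+s) lt = inj₁ (≤∧≢⇒< lt (b≢1+s ∘ sym))
  SwapWithSuc-reflects-< (fixed a≢s _) lower lt = inj₁ (≤∧≢⇒< (s≤s⁻¹ lt) a≢s)
  SwapWithSuc-reflects-< (fixed _ _) upper lt = inj₁ (m<n⇒m<1+n lt)
  SwapWithSuc-reflects-< (fixed _ _) (fixed _ _) lt = inj₁ lt

Cyclic : ∀ {n} → Table n → Fin n → Fin n → Fin n → Set
Cyclic T a b c = T a b < T a c × T b c < T b a × T c a < T c b

Cyclic-rotate : ∀ {n} {T : Table n} {a b c} → Cyclic T a b c → Cyclic T b c a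
Cyclic-rotate (ab<ac , bc<ba , ca<cb) = bc<ba , ca<cb , ab<ac

module _ {n} {T : Table n} (RT : IsRankingTable T) where

  open IsRankingTable RT

  positive-rank⇒off-diagonal : ∀ i {x r} → 1 ≤ r → T i x ≡ r → x ≢ i
  positive-rank⇒off-diagonal i 1≤r Tix≡r refl = <⇒≢ 1≤r (trans (sym (diag i)) Tix≡r)

  positive-rank-unique : ∀ i {x y r} → 1 ≤ r → T i x ≡ r → T i y ≡ r → x ≡ y
  positive-rank-unique i 1≤r Tix≡r Tiy≡r =
    injective i _ _ (positive-rank⇒off-diagonal i 1≤r Tix≡r)
                    (positive-rank⇒off-diagonal i 1≤r Tiy≡r) (trans Tix≡r (sym Tiy≡r))

module RowChange {n} {T T′ : Table n} {i : Fin n}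
                 (other-rows : ∀ {a} b → a ≢ i → T′ a b ≡ T a b) where

  module _ {s} (1≤s : 1 ≤ s) (1+s≤n∸1 : suc s ≤ n ∸ 1)
           (row-i : ∀ b → SwapWithSuc s (T i b) (T′ i b)) (RT : IsRankingTable T) where

    open IsRankingTable RT

    isRankingTable : IsRankingTable T′
    isRankingTable = record
      { diag = diag′ ; range = range′ ; injective = injective′ ; surjective = surjective′ }
      where
      diag′ : ∀ a → T′ a a ≡ 0
      diag′ a with a Fin.≟ i
      ... | yes refl = SwapWithSuc-fixes-0 1≤s (row-i a) (diag a)
      ... | no a≢i = trans (other-rows a a≢i) (diag a)

      range′ : ∀ a b → b ≢ a → 1 ≤ T′ a b × T′ a b ≤ n ∸ 1
      range′ a b b≢a with a Fin.≟ i
      ... | yes refl = SwapWithSuc-preserves-range 1≤s 1+s≤n∸1 (row-i b) (range a b b≢a)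
      ... | no a≢i = subst (λ m → 1 ≤ m × m ≤ n ∸ 1) (sym (other-rows b a≢i)) (range a b b≢a)

      injective′ : ∀ a x y → x ≢ a → y ≢ a → T′ a x ≡ T′ a y → x ≡ y
      injective′ a x y x≢a y≢a eq with a Fin.≟ i
      ... | yes refl = injective a x y x≢a y≢a
          (SwapWithSuc-injective (row-i x) (subst (SwapWithSuc s (T a y)) (sym eq) (row-i y)))
      ... | no a≢i = injective a x y x≢a y≢a
          (trans (sym (other-rows x a≢i)) (trans eq (other-rows y a≢i)))

      surjective′ : ∀ a r → 1 ≤ r → r ≤ n ∸ 1 → ∃[ x ] (x ≢ a × T′ a x ≡ r)
      surjective′ a r 1≤r r≤n∸1 with a Fin.≟ i
      ... | yes refl =
        let r̃ = swapWithSuc s r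
            r~r̃ = swapWithSuc-view s r
            1≤r̃ , r̃≤n∸1 = SwapWithSuc-preserves-range 1≤s 1+s≤n∸1 r~r̃ (1≤r , r≤n∸1)
            x , x≢a , Tax≡r̃ = surjective a r̃ 1≤r̃ r̃≤n∸1
            r̃~T′ax = subst (λ m → SwapWithSuc s m (T′ a x)) Tax≡r̃ (row-i x)
        in x , x≢a , SwapWithSuc-functional r̃~T′ax (SwapWithSuc-sym r~r̃)
      ... | no a≢i =
        let x , x≢a , Tax≡r = surjective a r 1≤r r≤n∸1
        in x , x≢a , trans (other-rows x a≢i) Tax≡r

  private
    rotate : ∀ {a b c} → Cyclic T a b c → Cyclic T b c a
    rotate = Cyclic-rotate {T = T}

    rotate′ : ∀ {a b c} → Cyclic T′ a b c → Cyclic T′ b c a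
    rotate′ = Cyclic-rotate {T = T′}

  <-off-row : ∀ {a b c} → a ≢ i → T′ a b < T′ a c → T a b < T a c
  <-off-row {a} {b} {c} a≢i = subst₂ _<_ (other-rows b a≢i) (other-rows c a≢i)

  module _ {j k} (row-i-order : ∀ x y → T′ i x < T′ i y → T i x < T i y ⊎ (x ≡ k × y ≡ j))
           (exception : ¬ (T j i < T j k × T k j < T k i)) where

    Cyclic-reflect-from-i : ∀ {b c} → i ≢ b → i ≢ c → Cyclic T′ i b c → Cyclic T i b c
    Cyclic-reflect-from-i i≢b i≢c (ib<ic , bc<bi , ci<cb) with row-i-order _ _ ib<ic
    ... | inj₁ ib<ic′ = ib<ic′ , <-off-row (i≢b ∘ sym) bc<bi , <-off-row (i≢c ∘ sym) ci<cb
    ... | inj₂ (refl , refl) =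
      contradiction (<-off-row (i≢c ∘ sym) ci<cb , <-off-row (i≢b ∘ sym) bc<bi) exception

    Cyclic-reflect : ∀ {a b c} → a ≢ b → b ≢ c → a ≢ c → Cyclic T′ a b c → Cyclic T a b c
    Cyclic-reflect {a} {b} {c} a≢b b≢c a≢c cyc with a Fin.≟ i | b Fin.≟ i | c Fin.≟ i
    ... | yes refl | _ | _ = Cyclic-reflect-from-i a≢b a≢c cyc
    ... | no _ | yes refl | _ =
      rotate (rotate (Cyclic-reflect-from-i b≢c (a≢b ∘ sym) (rotate′ cyc)))
    ... | no _ | no _ | yes refl =
      rotate (Cyclic-reflect-from-i (a≢c ∘ sym) (b≢c ∘ sym) (rotate′ (rotate′ cyc)))
    ... | no a≢i | no b≢i | no c≢i =
      let ab<ac , bc<ba , ca<cb = cyc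
      in <-off-row a≢i ab<ac , <-off-row b≢i bc<ba , <-off-row c≢i ca<cb

    threeConcordant : ThreeConcordant T → ThreeConcordant T′
    threeConcordant C a b c a≢b b≢c a≢c = C a b c a≢b b≢c a≢c ∘ Cyclic-reflect a≢b b≢c a≢c

swapInRow-other-row : ∀ {n} (T : Table n) {i j k a} b → a ≢ i → swapInRow T i j k a b ≡ T a b
swapInRow-other-row T {i} {a = a} b a≢i with a Fin.≟ i
... | yes a≡i = contradiction a≡i a≢i
... | no _ = refl

module _ {n} {T : Table n} (RT : IsRankingTable T) {i j k s}
         (1≤s : 1 ≤ s) (rank-j : T i j ≡ s) (rank-k : T i k ≡ suc s) where

  swapInRow-consecutive : ∀ b → SwapWithSuc s (T i b) (swapInRow T i j k i b)
  swapInRow-consecutive b with i Fin.≟ i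
  ... | no i≢i = contradiction refl i≢i
  ... | yes _ with b Fin.≟ j
  ...   | yes refl = subst₂ (SwapWithSuc s) (sym rank-j) (sym rank-k) lower
  ...   | no b≢j with b Fin.≟ k
  ...     | yes refl = subst₂ (SwapWithSuc s) (sym rank-k) (sym rank-j) upper
  ...     | no b≢k = fixed (λ Tib≡s → b≢j (positive-rank-unique RT i 1≤s Tib≡s rank-j))
                           (λ Tib≡1+s → b≢k (positive-rank-unique RT i (s≤s z≤n) Tib≡1+s rank-k))

  swapInRow-order : ∀ x y → swapInRow T i j k i x < swapInRow T i j k i y →
                    T i x < T i y ⊎ (x ≡ k × y ≡ j)
  swapInRow-order x y lt
    with SwapWithSuc-reflects-< (swapInRow-consecutive x) (swapInRow-consecutive y) lt
  ... | inj₁ Tix<Tiy = inj₁ Tix<Tiy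
  ... | inj₂ (Tix≡1+s , Tiy≡s) =
    inj₂ ( positive-rank-unique RT i (s≤s z≤n) Tix≡1+s rank-k
         , positive-rank-unique RT i 1≤s Tiy≡s rank-j )

lemma7p2 : ∀ {n : ℕ} (T T' : Table n) (i : Fin n) (s : ℕ) (j k : Fin n) →
    Presents3Concordant T →
    ConsecutiveTransposition T T' i s j k →
    ¬ (T j i < T j k × T k j < T k i) →
    Presents3Concordant T'
lemma7p2 {n} T T' i s j k (RT , C) ct exception rewrite ConsecutiveTransposition.result ct =
  RowChange.isRankingTable other-rows s-lower 1+s≤n∸1
    (swapInRow-consecutive RT s-lower rank-j rank-k) RT ,
  RowChange.threeConcordant other-rows (swapInRow-order RT s-lower rank-j rank-k) exception C
  where
  open ConsecutiveTransposition ct using (s-lower; rank-j; rank-k)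

  other-rows : ∀ {a} b → a ≢ i → swapInRow T i j k a b ≡ T a b
  other-rows = swapInRow-other-row T

  -- Read off from the rank of x_k.
  1+s≤n∸1 : suc s ≤ n ∸ 1
  1+s≤n∸1 = subst (_≤ n ∸ 1) rank-k
    (proj₂ (IsRankingTable.range RT i k (positive-rank⇒off-diagonal RT i (s≤s z≤n) rank-k)))
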